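{- For every $m\ge1$, the following identity of rational functions in $x_1,\dots,x_m,t$ holds: $$\sum_{i=1}^m\frac{x_i\oplus x_i}{x_i\ominus t}\prod_{j\ne i}\frac{x_i\oplus x_j}{x_i\ominus x_j}+\prod_{i=1}^m\frac{t\oplus x_i}{t\ominus x_i}=1.$$
   Context: $\beta$ is an indeterminate; $x\oplus y=x+y+\beta xy$ and $x\ominus y=(x-y)/(1+\beta y)$. -}

module Defs where

open import Data.Nat using (ℕ; zero; suc)
open import Data.Integer using (+_; +[1+_]; -[1+_])
open import Data.Rational using (ℚ; mkℚ; 0ℚ; 1ℚ; _+_; _-_; _*_; _÷_)
open import Data.Fin using (Fin; zero; suc)
open import Relation.Nullary using (yes; no)
open import Data.Fin using (_≟_)

-- Total division on ℚ: q / 0 := 0 (only used where the divisor is nonzero).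
_/'_ : ℚ → ℚ → ℚ
p /' mkℚ (+ zero) d c = 0ℚ
p /' q@(mkℚ +[1+ n ] d c) = p ÷ q
p /' q@(mkℚ -[1+ n ] d c) = p ÷ q
infixl 7 _/'_

_⊕⟨_⟩_ : ℚ → ℚ → ℚ → ℚ
x ⊕⟨ β ⟩ y = x + y + β * x * y

_⊖⟨_⟩_ : ℚ → ℚ → ℚ → ℚ
x ⊖⟨ β ⟩ y = (x - y) /' (1ℚ + β * y)

sumFin : (m : ℕ) → (Fin m → ℚ) → ℚ
sumFin zero f = 0ℚ
sumFin (suc m) f = f zero + sumFin m (λ i → f (suc i))

prodFin : (m : ℕ) → (Fin m → ℚ) → ℚ
prodFin zero f = 1ℚ
prodFin (suc m) f = f zero * prodFin m (λ i → f (suc i))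

prodExcept : (m : ℕ) → Fin m → (Fin m → ℚ) → ℚ
prodExcept m i f = prodFin m (λ j → g j (j ≟ i))
  where
  g : (j : Fin m) → _ → ℚ
  g j (yes _) = 1ℚ
  g j (no _) = f j

{-# OPTIONS --safe #-}
-- Write ratio(u,v) = (u ⊕ v)/(u ⊖ v) and weight(u,t) = (u ⊕ u)/(u ⊖ t), and let
-- E(x; t) be the left-hand side for the points x = (x₁, …, xₘ). Split off y = x₁
-- and let x' be the remaining points. The partial-fraction identity
--   ratio(x,y)/(x ⊖ t) = ratio(t,y)/(x ⊖ t) + weight(y,t)/(x ⊖ y)
-- splits every summand with i ≠ 1 into a summand of E(x'; t) and one of E(x'; y),
-- while the summand i = 1 is weight(y,t) times the product part of E(x'; y). Hence
--   E(x; t) = ratio(t,y) E(x'; t) + weight(y,t) E(x'; y) = ratio(t,y) + weight(y,t),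
-- which is 1 by the two-point identity (the case m = 1). The induction can start at
-- m = 0, where the identity reads 0 + 1 = 1.
module Submission where

open import Data.Nat using (ℕ; zero; suc; _≥_)
open import Data.Integer using (+0; +[1+_]; -[1+_])
open import Data.Rational using (ℚ; mkℚ; 0ℚ; 1ℚ; _+_; _*_; _-_; 1/_; _÷_; ≢-nonZero)
open import Data.Rational.Properties
  using (*-assoc; *-identityˡ; *-identityʳ; *-zeroˡ; *-inverseˡ; *-inverseʳ; +-0-group)
open import Data.Rational.Solver using (module +-*-Solver)
open import Algebra.Properties.Group +-0-group using (x∙y⁻¹≈ε⇒x≈y)
open import Data.Fin using (Fin; zero; suc; _≟_)
open import Data.Fin.Properties using (suc-injective)
open import Relation.Nullary using (yes; no)
open import Relation.Binary.PropositionalEquality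
open import Function using (_∘_)

open import Defs

open +-*-Solver
open ≡-Reasoning

/'≡÷ : ∀ a {b} (b≢0 : b ≢ 0ℚ) → a /' b ≡ (a ÷ b) {{≢-nonZero b≢0}}
/'≡÷ a {mkℚ +0 _ _} b≢0 with ≢-nonZero b≢0
... | ()
/'≡÷ a {mkℚ +[1+ _ ] _ _} _ = refl
/'≡÷ a {mkℚ -[1+ _ ] _ _} _ = refl

/'-*-cancel : ∀ a {b} → b ≢ 0ℚ → a /' b * b ≡ a
/'-*-cancel a {b} b≢0 = begin
  a /' b * b     ≡⟨ cong (_* b) (/'≡÷ a b≢0) ⟩
  a * 1/ b * b   ≡⟨ *-assoc a (1/ b) b ⟩
  a * (1/ b * b) ≡⟨ cong (a *_) (*-inverseˡ b) ⟩
  a * 1ℚ         ≡⟨ *-identityʳ a ⟩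
  a              ∎
  where instance _ = ≢-nonZero b≢0

*-/'-cancel : ∀ a {b} → b ≢ 0ℚ → a * b /' b ≡ a
*-/'-cancel a {b} b≢0 = begin
  a * b /' b     ≡⟨ /'≡÷ (a * b) b≢0 ⟩
  a * b * 1/ b   ≡⟨ *-assoc a b (1/ b) ⟩
  a * (b * 1/ b) ≡⟨ cong (a *_) (*-inverseʳ b) ⟩
  a * 1ℚ         ≡⟨ *-identityʳ a ⟩
  a              ∎
  where instance _ = ≢-nonZero b≢0

*-cancelʳ-≡ : ∀ a b {c} → c ≢ 0ℚ → a * c ≡ b * c → a ≡ b
*-cancelʳ-≡ a b {c} c≢0 eq = begin
  a          ≡⟨ *-/'-cancel a c≢0 ⟨
  a * c /' c ≡⟨ cong (_/' c) eq ⟩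
  b * c /' c ≡⟨ *-/'-cancel b c≢0 ⟩
  b          ∎

*-≢0 : ∀ {a b} → a ≢ 0ℚ → b ≢ 0ℚ → a * b ≢ 0ℚ
*-≢0 {a} {b} a≢0 b≢0 ab≡0 = a≢0 (*-cancelʳ-≡ a 0ℚ b≢0 (trans ab≡0 (sym (*-zeroˡ b))))

/'-≢0 : ∀ {a b} → a ≢ 0ℚ → b ≢ 0ℚ → a /' b ≢ 0ℚ
/'-≢0 {a} {b} a≢0 b≢0 a/b≡0 =
  a≢0 (trans (sym (/'-*-cancel a b≢0)) (trans (cong (_* b) a/b≡0) (*-zeroˡ b)))

-≢0 : ∀ {x y} → x ≢ y → x - y ≢ 0ℚ
-≢0 {x} {y} x≢y x-y≡0 = x≢y (x∙y⁻¹≈ε⇒x≈y x y x-y≡0)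

/'-unique : ∀ {a b} c → b ≢ 0ℚ → a ≡ c * b → a /' b ≡ c
/'-unique {a} c b≢0 a≡cb = *-cancelʳ-≡ _ c b≢0 (trans (/'-*-cancel a b≢0) a≡cb)

/'-cross : ∀ {a b c d} → b ≢ 0ℚ → d ≢ 0ℚ → a * d ≡ c * b → a /' b ≡ c /' d
/'-cross {a} {b} {c} {d} b≢0 d≢0 ad≡cb = /'-unique (c /' d) b≢0 (*-cancelʳ-≡ a _ d≢0 (begin
  a * d             ≡⟨ ad≡cb ⟩
  c * b             ≡⟨ cong (_* b) (/'-*-cancel c d≢0) ⟨
  c /' d * d * b    ≡⟨ solve 3 (λ q d b → q :* d :* b := q :* b :* d) refl (c /' d) d b ⟩
  c /' d * b * d    ∎))

/'-+-/' : ∀ a {b} c {d} → b ≢ 0ℚ → d ≢ 0ℚ → a /' b + c /' d ≡ (a * d + c * b) /' (b * d)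
/'-+-/' a {b} c {d} b≢0 d≢0 = sym (/'-unique _ (*-≢0 b≢0 d≢0) (begin
  a * d + c * b                             ≡⟨ cong₂ (λ p q → p * d + q * b) (/'-*-cancel a b≢0) (/'-*-cancel c d≢0) ⟨
  a /' b * b * d + c /' d * d * b           ≡⟨ solve 4 (λ p q b d → p :* b :* d :+ q :* d :* b := (p :+ q) :* (b :* d)) refl (a /' b) (c /' d) b d ⟩
  (a /' b + c /' d) * (b * d)               ∎))

/'-*-/' : ∀ a {b} c {d} → b ≢ 0ℚ → d ≢ 0ℚ → a /' b * (c /' d) ≡ (a * c) /' (b * d)
/'-*-/' a {b} c {d} b≢0 d≢0 = sym (/'-unique _ (*-≢0 b≢0 d≢0) (begin
  a * c                         ≡⟨ cong₂ _*_ (/'-*-cancel a b≢0) (/'-*-cancel c d≢0) ⟨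
  a /' b * b * (c /' d * d)     ≡⟨ solve 4 (λ p q b d → p :* b :* (q :* d) := p :* q :* (b :* d)) refl (a /' b) (c /' d) b d ⟩
  a /' b * (c /' d) * (b * d)   ∎))

/'-⊖ : ∀ β p {u v} → 1ℚ + β * v ≢ 0ℚ → u ≢ v → p /' (u ⊖⟨ β ⟩ v) ≡ p * (1ℚ + β * v) /' (u - v)
/'-⊖ β p {u} {v} s≢0 u≢v = /'-cross (/'-≢0 (-≢0 u≢v) s≢0) (-≢0 u≢v) (begin
  p * (u - v)                  ≡⟨ cong (p *_) (/'-*-cancel (u - v) s≢0) ⟨
  p * ((u - v) /' s * s)       ≡⟨ solve 3 (λ p q s → p :* (q :* s) := p :* s :* q) refl p ((u - v) /' s) s ⟩
  p * s * (u ⊖⟨ β ⟩ v)         ∎)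
  where
  s : ℚ
  s = 1ℚ + β * v

ratio : ℚ → ℚ → ℚ → ℚ
ratio β u v = (u ⊕⟨ β ⟩ v) /' (u ⊖⟨ β ⟩ v)

weight : ℚ → ℚ → ℚ → ℚ
weight β u t = (u ⊕⟨ β ⟩ u) /' (u ⊖⟨ β ⟩ t)

ratio+weight≡1 : ∀ β {t y} → 1ℚ + β * t ≢ 0ℚ → 1ℚ + β * y ≢ 0ℚ → y ≢ t →
                 ratio β t y + weight β y t ≡ 1ℚ
ratio+weight≡1 β {t} {y} s≢0 a≢0 y≢t = begin
  ratio β t y + weight β y t
    ≡⟨ cong₂ _+_ (/'-⊖ β _ a≢0 t≢y) (/'-⊖ β _ s≢0 y≢t) ⟩
  (t ⊕⟨ β ⟩ y) * a /' (t - y) + (y ⊕⟨ β ⟩ y) * s /' (y - t)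
    ≡⟨ /'-+-/' _ _ (-≢0 t≢y) (-≢0 y≢t) ⟩
  ((t ⊕⟨ β ⟩ y) * a * (y - t) + (y ⊕⟨ β ⟩ y) * s * (t - y)) /' ((t - y) * (y - t))
    ≡⟨ /'-unique 1ℚ (*-≢0 (-≢0 t≢y) (-≢0 y≢t)) numerator ⟩
  1ℚ ∎
  where
  s a : ℚ
  s = 1ℚ + β * t
  a = 1ℚ + β * y
  t≢y : t ≢ y
  t≢y = y≢t ∘ sym
  numerator : (t ⊕⟨ β ⟩ y) * a * (y - t) + (y ⊕⟨ β ⟩ y) * s * (t - y) ≡ 1ℚ * ((t - y) * (y - t))
  numerator = solve 3 (λ β t y →
      (t :+ y :+ β :* t :* y) :* (con 1ℚ :+ β :* y) :* (y :- t) :+ (y :+ y :+ β :* y :* y) :* (con 1ℚ :+ β :* t) :* (t :- y)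
    := con 1ℚ :* ((t :- y) :* (y :- t))) refl β t y

partial-fractions : ∀ β A {x y t} → 1ℚ + β * t ≢ 0ℚ → 1ℚ + β * y ≢ 0ℚ → x ≢ t → x ≢ y → y ≢ t →
  A /' (x ⊖⟨ β ⟩ t) * ratio β x y ≡ ratio β t y * (A /' (x ⊖⟨ β ⟩ t)) + weight β y t * (A /' (x ⊖⟨ β ⟩ y))
partial-fractions β A {x} {y} {t} s≢0 a≢0 x≢t x≢y y≢t = begin
  A /' (x ⊖⟨ β ⟩ t) * ratio β x y
    ≡⟨ cong₂ _*_ (/'-⊖ β A s≢0 x≢t) (/'-⊖ β _ a≢0 x≢y) ⟩
  A * s /' (x - t) * ((x ⊕⟨ β ⟩ y) * a /' (x - y))
    ≡⟨ /'-*-/' _ _ x-t≢0 x-y≢0 ⟩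
  A * s * ((x ⊕⟨ β ⟩ y) * a) /' ((x - t) * (x - y))
    ≡⟨ /'-cross (*-≢0 x-t≢0 x-y≢0) (*-≢0 (*-≢0 t-y≢0 x-t≢0) (*-≢0 y-t≢0 x-y≢0)) cross-multiplied ⟩
  (p * ((y - t) * (x - y)) + q * ((t - y) * (x - t))) /' ((t - y) * (x - t) * ((y - t) * (x - y)))
    ≡⟨ /'-+-/' p q (*-≢0 t-y≢0 x-t≢0) (*-≢0 y-t≢0 x-y≢0) ⟨
  p /' ((t - y) * (x - t)) + q /' ((y - t) * (x - y))
    ≡⟨ cong₂ _+_ (/'-*-/' _ _ t-y≢0 x-t≢0) (/'-*-/' _ _ y-t≢0 x-y≢0) ⟨
  (t ⊕⟨ β ⟩ y) * a /' (t - y) * (A * s /' (x - t)) + (y ⊕⟨ β ⟩ y) * s /' (y - t) * (A * a /' (x - y))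
    ≡⟨ cong₂ _+_ (cong₂ _*_ (/'-⊖ β _ a≢0 t≢y) (/'-⊖ β A s≢0 x≢t))
                 (cong₂ _*_ (/'-⊖ β _ s≢0 y≢t) (/'-⊖ β A a≢0 x≢y)) ⟨
  ratio β t y * (A /' (x ⊖⟨ β ⟩ t)) + weight β y t * (A /' (x ⊖⟨ β ⟩ y)) ∎
  where
  s a p q : ℚ
  s = 1ℚ + β * t
  a = 1ℚ + β * y
  p = (t ⊕⟨ β ⟩ y) * a * (A * s)
  q = (y ⊕⟨ β ⟩ y) * s * (A * a)
  t≢y : t ≢ y
  t≢y = y≢t ∘ sym
  x-t≢0 : x - t ≢ 0ℚ
  x-t≢0 = -≢0 x≢t
  x-y≢0 : x - y ≢ 0ℚ
  x-y≢0 = -≢0 x≢y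
  y-t≢0 : y - t ≢ 0ℚ
  y-t≢0 = -≢0 y≢t
  t-y≢0 : t - y ≢ 0ℚ
  t-y≢0 = -≢0 t≢y
  cross-multiplied :
    A * s * ((x ⊕⟨ β ⟩ y) * a) * ((t - y) * (x - t) * ((y - t) * (x - y)))
    ≡ (p * ((y - t) * (x - y)) + q * ((t - y) * (x - t))) * ((x - t) * (x - y))
  cross-multiplied = solve 5 (λ β A x y t →
      A :* (con 1ℚ :+ β :* t) :* ((x :+ y :+ β :* x :* y) :* (con 1ℚ :+ β :* y))
        :* ((t :- y) :* (x :- t) :* ((y :- t) :* (x :- y)))
    := ((t :+ y :+ β :* t :* y) :* (con 1ℚ :+ β :* y) :* (A :* (con 1ℚ :+ β :* t)) :* ((y :- t) :* (x :- y))
        :+ (y :+ y :+ β :* y :* y) :* (con 1ℚ :+ β :* t) :* (A :* (con 1ℚ :+ β :* y)) :* ((t :- y) :* (x :- t)))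
        :* ((x :- t) :* (x :- y))) refl β A x y t

sumFin-cong : ∀ m {f g : Fin m → ℚ} → (∀ i → f i ≡ g i) → sumFin m f ≡ sumFin m g
sumFin-cong zero    f≗g = refl
sumFin-cong (suc m) f≗g = cong₂ _+_ (f≗g zero) (sumFin-cong m (f≗g ∘ suc))

prodFin-cong : ∀ m {f g : Fin m → ℚ} → (∀ i → f i ≡ g i) → prodFin m f ≡ prodFin m g
prodFin-cong zero    f≗g = refl
prodFin-cong (suc m) f≗g = cong₂ _*_ (f≗g zero) (prodFin-cong m (f≗g ∘ suc))

sumFin-linear : ∀ m r w (f g : Fin m → ℚ) →
                sumFin m (λ i → r * f i + w * g i) ≡ r * sumFin m f + w * sumFin m g
sumFin-linear zero    r w f g = solve 2 (λ r w → con 0ℚ := r :* con 0ℚ :+ w :* con 0ℚ) refl r w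
sumFin-linear (suc m) r w f g = begin
  r * f zero + w * g zero + sumFin m (λ i → r * f (suc i) + w * g (suc i))
    ≡⟨ cong ((r * f zero + w * g zero) +_) (sumFin-linear m r w (f ∘ suc) (g ∘ suc)) ⟩
  r * f zero + w * g zero + (r * sumFin m (f ∘ suc) + w * sumFin m (g ∘ suc))
    ≡⟨ solve 6 (λ r w a b c d → r :* a :+ w :* b :+ (r :* c :+ w :* d) := r :* (a :+ c) :+ w :* (b :+ d))
             refl r w (f zero) (g zero) (sumFin m (f ∘ suc)) (sumFin m (g ∘ suc)) ⟩
  r * (f zero + sumFin m (f ∘ suc)) + w * (g zero + sumFin m (g ∘ suc)) ∎

-- The factors of prodExcept are values of a function local to Defs that cannot be
-- named here, so the type of prodExcept-suc-factor is left to be inferred from its use.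
mutual
  prodExcept-suc : ∀ m i (f : Fin (suc m) → ℚ) →
                   prodExcept (suc m) (suc i) f ≡ f zero * prodExcept m i (f ∘ suc)
  prodExcept-suc m i f = cong (f zero *_) (prodFin-cong m (prodExcept-suc-factor m i f))

  prodExcept-suc-factor : ∀ m (i : Fin m) (f : Fin (suc m) → ℚ) (j : Fin m) → _
  prodExcept-suc-factor m i f j with j ≟ i
  ... | yes _ = refl
  ... | no  _ = refl

sumPart : ∀ {m} → ℚ → (Fin m → ℚ) → ℚ → ℚ
sumPart {m} β x t = sumFin m (λ i → weight β (x i) t * prodExcept m i (λ j → ratio β (x i) (x j)))

prodPart : ∀ {m} → ℚ → (Fin m → ℚ) → ℚ → ℚ
prodPart {m} β x t = prodFin m (λ i → ratio β t (x i))

sumPart-recurrence : ∀ {m} β t (x : Fin (suc m) → ℚ) →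
  1ℚ + β * t ≢ 0ℚ → 1ℚ + β * x zero ≢ 0ℚ → (∀ i → x i ≢ t) → (∀ i → x (suc i) ≢ x zero) →
  let y = x zero ; xs = x ∘ suc in
  sumPart β x t ≡ weight β y t * prodPart β xs y + (ratio β t y * sumPart β xs t + weight β y t * sumPart β xs y)
sumPart-recurrence {m} β t x s≢0 a≢0 x≢t xs≢y = cong₂ _+_ (cong (w *_) (*-identityˡ _)) (begin
  sumFin m (λ i → u i * prodExcept (suc m) (suc i) (λ j → ratio β (xs i) (x j)))
    ≡⟨ sumFin-cong m (λ i → cong (u i *_) (prodExcept-suc m i (λ j → ratio β (xs i) (x j)))) ⟩
  sumFin m (λ i → u i * (ratio β (xs i) y * P i))
    ≡⟨ sumFin-cong m split ⟩
  sumFin m (λ i → r * (u i * P i) + w * (v i * P i))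
    ≡⟨ sumFin-linear m r w _ _ ⟩
  r * sumPart β xs t + w * sumPart β xs y ∎)
  where
  y r w : ℚ
  y = x zero
  r = ratio β t y
  w = weight β y t
  xs : Fin m → ℚ
  xs = x ∘ suc
  u v P : Fin m → ℚ
  u i = weight β (xs i) t
  v i = weight β (xs i) y
  P i = prodExcept m i (λ j → ratio β (xs i) (xs j))
  split : ∀ i → u i * (ratio β (xs i) y * P i) ≡ r * (u i * P i) + w * (v i * P i)
  split i = begin
    u i * (ratio β (xs i) y * P i)   ≡⟨ *-assoc (u i) _ (P i) ⟨
    u i * ratio β (xs i) y * P i     ≡⟨ cong (_* P i) (partial-fractions β _ s≢0 a≢0 (x≢t (suc i)) (xs≢y i) (x≢t zero)) ⟩
    (r * u i + w * v i) * P i        ≡⟨ solve 5 (λ r u w v P → (r :* u :+ w :* v) :* P := r :* (u :* P) :+ w :* (v :* P))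
                                                refl r (u i) w (v i) (P i) ⟩
    r * (u i * P i) + w * (v i * P i) ∎

sumPart+prodPart≡1 : ∀ {m} β t (x : Fin m → ℚ) →
  1ℚ + β * t ≢ 0ℚ → (∀ i → 1ℚ + β * x i ≢ 0ℚ) → (∀ i → x i ≢ t) → (∀ i j → i ≢ j → x i ≢ x j) →
  sumPart β x t + prodPart β x t ≡ 1ℚ
sumPart+prodPart≡1 {zero}  β t x _   _   _   _         = refl
sumPart+prodPart≡1 {suc m} β t x s≢0 a≢0 x≢t x-injective = begin
  sumPart β x t + r * prodPart β xs t
    ≡⟨ cong (_+ r * prodPart β xs t) (sumPart-recurrence β t x s≢0 (a≢0 zero) x≢t xs≢y) ⟩
  w * prodPart β xs y + (r * sumPart β xs t + w * sumPart β xs y) + r * prodPart β xs t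
    ≡⟨ solve 6 (λ w r Πy St Sy Πt → w :* Πy :+ (r :* St :+ w :* Sy) :+ r :* Πt := w :* (Sy :+ Πy) :+ r :* (St :+ Πt))
             refl w r (prodPart β xs y) (sumPart β xs t) (sumPart β xs y) (prodPart β xs t) ⟩
  w * (sumPart β xs y + prodPart β xs y) + r * (sumPart β xs t + prodPart β xs t)
    ≡⟨ cong₂ (λ p q → w * p + r * q)
             (sumPart+prodPart≡1 β y xs (a≢0 zero) (a≢0 ∘ suc) xs≢y xs-injective)
             (sumPart+prodPart≡1 β t xs s≢0 (a≢0 ∘ suc) (x≢t ∘ suc) xs-injective) ⟩
  w * 1ℚ + r * 1ℚ
    ≡⟨ solve 2 (λ w r → w :* con 1ℚ :+ r :* con 1ℚ := r :+ w) refl w r ⟩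
  r + w
    ≡⟨ ratio+weight≡1 β s≢0 (a≢0 zero) (x≢t zero) ⟩
  1ℚ ∎
  where
  y r w : ℚ
  y = x zero
  r = ratio β t y
  w = weight β y t
  xs : Fin m → ℚ
  xs = x ∘ suc
  xs≢y : ∀ i → xs i ≢ y
  xs≢y i = x-injective (suc i) zero λ ()
  xs-injective : ∀ i j → i ≢ j → xs i ≢ xs j
  xs-injective i j i≢j = x-injective (suc i) (suc j) (i≢j ∘ suc-injective)

lemma2p4 : (m : ℕ) → m ≥ 1 → (β t : ℚ) → (x : Fin m → ℚ)
    → 1ℚ + β * t ≢ 0ℚ
    → (∀ i → 1ℚ + β * x i ≢ 0ℚ)
    → (∀ i → x i ≢ t)
    → (∀ i j → i ≢ j → x i ≢ x j)
    → sumFin m (λ i → ((x i ⊕⟨ β ⟩ x i) /' (x i ⊖⟨ β ⟩ t))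
                       * prodExcept m i (λ j → (x i ⊕⟨ β ⟩ x j) /' (x i ⊖⟨ β ⟩ x j)))
      + prodFin m (λ i → (t ⊕⟨ β ⟩ x i) /' (t ⊖⟨ β ⟩ x i))
      ≡ 1ℚ
lemma2p4 m _ β t x = sumPart+prodPart≡1 β t x
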